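{- Let $S\subset\mathbb{N}$ be a $2$-syndetic set. Then $S$ contains infinitely many two-element sets of the form $\{x,xr^2\}$ with $x,r\in\mathbb{N}$, or $S$ contains infinitely many odd perfect squares.
   Context: $\mathbb{N}=\{1,2,3,\dots\}$. A set $S\subset\mathbb{N}$ is $2$-syndetic if for every $n\in\mathbb{N}$ at least one of $n,n+1$ lies in $S$. -}

module Defs where

open import Data.Nat using (ℕ; suc; _*_; _+_; _<_; _≤_)
open import Data.Product using (Σ; _×_; ∃-syntax)
open import Data.Sum using (_⊎_)
open import Relation.Binary.PropositionalEquality using (_≡_)

-- Subsets of ℕ are predicates; only positive elements are relevant since ℕ = {1,2,3,...}.
-- S is 2-syndetic: for every n ≥ 1, at least one of n, n+1 lies in S.
TwoSyndetic : (ℕ → Set) → Set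
TwoSyndetic S = ∀ n → 1 ≤ n → S n ⊎ S (suc n)

-- Two-element forces r ≥ 2. "Infinitely many" such sets is expressed as: the larger
-- element x r² is unbounded (for every bound N there is such a set with x r² > N),
-- which is equivalent since only finitely many such sets have maximum ≤ N.
InfManyPairs : (ℕ → Set) → Set
InfManyPairs S = ∀ N → ∃[ x ] ∃[ r ] (1 ≤ x × 2 ≤ r × N < x * (r * r) × S x × S (x * (r * r)))

InfManyOddSquares : (ℕ → Set) → Set
InfManyOddSquares S = ∀ N → ∃[ k ] (N < (2 * k + 1) * (2 * k + 1) × S ((2 * k + 1) * (2 * k + 1)))

{-# OPTIONS --safe #-}
module Submission where

-- If x ∈ S and x t² = y + 1 with t ≥ 2, then
-- either x t² ∈ S, or y ∈ S.  In the latter case the cube of t √x + √y, whose norm is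
-- (x t² − y)³ = 1, gives x (t (4y + 1))² = y (4y + 3)² + 1; one of these two consecutive numbers
-- lies in S and completes the pair {x, x (t (4y + 1))²} or {y, y (4y + 3)²}.  As 1 or 2 lies in S
-- and t can be taken arbitrarily large, such pairs are unbounded.

open import Defs
open import Data.Nat using (ℕ; suc; _+_; _*_; _≤_; _<_; z≤n; s≤s)
open import Data.Nat.Properties using (m≤m+n; m≤m*n; n≤1+n; ≤-trans; ≤-<-trans; <-≤-trans)
open import Data.Nat.Tactic.RingSolver using (solve-∀)
open import Data.Product using (_×_; _,_; ∃-syntax)
open import Data.Sum using (_⊎_; inj₁; inj₂; [_,_])
open import Relation.Binary.PropositionalEquality using (_≡_; refl; subst; sym; cong; module ≡-Reasoning)
open import Relation.Nullary using (¬_)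

SquareRatioPairAbove : (ℕ → Set) → ℕ → Set
SquareRatioPairAbove S N = ∃[ x ] ∃[ r ] (1 ≤ x × 2 ≤ r × N < x * (r * r) × S x × S (x * (r * r)))

pell-cube : ∀ y → suc (y * ((3 + 4 * y) * (3 + 4 * y))) ≡ suc y * ((1 + 4 * y) * (1 + 4 * y))
pell-cube = solve-∀

*-square-distrib : ∀ x t u → x * ((t * u) * (t * u)) ≡ x * (t * t) * (u * u)
*-square-distrib = solve-∀

suc-pred-of-square-multiple : ∀ x t → 1 ≤ x → ∃[ y ] (suc y ≡ x * (suc t * suc t) × t ≤ y)
suc-pred-of-square-multiple (suc x) t _ =
  t + t * suc t + x * (suc t * suc t) , refl , ≤-trans (m≤m+n t (t * suc t)) (m≤m+n _ _)

module _ {S : ℕ → Set} (syndetic : TwoSyndetic S) where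

  open ≡-Reasoning

  positive-element : ∃[ x ] (1 ≤ x × S x)
  positive-element with syndetic 1 (s≤s z≤n)
  ... | inj₁ S1 = 1 , s≤s z≤n , S1
  ... | inj₂ S2 = 2 , s≤s z≤n , S2

  pair-above-from-predecessor : ∀ {x y N} t → S x → S y → 1 ≤ x → 2 ≤ t →
                                suc y ≡ x * (t * t) → N < y → SquareRatioPairAbove S N
  pair-above-from-predecessor {x} {y} {N} t Sx Sy 1≤x 2≤t y+1≡xt² N<y =
    [ pair-at-y , pair-at-x ] (syndetic (y * (r * r)) (≤-trans 1≤y y≤yr²))
    where
    r u s : ℕ
    r = 3 + 4 * y
    u = 1 + 4 * y
    s = t * u

    1≤y : 1 ≤ y
    1≤y = ≤-<-trans z≤n N<y

    y≤yr² : y ≤ y * (r * r)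
    y≤yr² = m≤m*n y (r * r)

    yr²+1≡xs² : suc (y * (r * r)) ≡ x * (s * s)
    yr²+1≡xs² = begin
      suc (y * (r * r))       ≡⟨ pell-cube y ⟩
      suc y * (u * u)         ≡⟨ cong (_* (u * u)) y+1≡xt² ⟩
      x * (t * t) * (u * u)   ≡⟨ sym (*-square-distrib x t u) ⟩
      x * (s * s)             ∎

    pair-at-y : S (y * (r * r)) → SquareRatioPairAbove S N
    pair-at-y Syr² = y , r , 1≤y , s≤s (s≤s z≤n) , <-≤-trans N<y y≤yr² , Sy , Syr²

    pair-at-x : S (suc (y * (r * r))) → SquareRatioPairAbove S N
    pair-at-x S[yr²+1] =
      x , s , 1≤x , ≤-trans 2≤t (m≤m*n t u) ,
      subst (N <_) yr²+1≡xs² (<-≤-trans N<y (≤-trans y≤yr² (n≤1+n _))) ,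
      Sx , subst S yr²+1≡xs² S[yr²+1]

  pair-above : ∀ {x y N} t → S x → 1 ≤ x → 2 ≤ t →
               suc y ≡ x * (t * t) → N < y → SquareRatioPairAbove S N
  pair-above {x} {y} {N} t Sx 1≤x 2≤t y+1≡xt² N<y =
    [ (λ Sy → pair-above-from-predecessor t Sx Sy 1≤x 2≤t y+1≡xt² N<y) , pair-at-square ]
      (syndetic y (≤-<-trans z≤n N<y))
    where
    pair-at-square : S (suc y) → SquareRatioPairAbove S N
    pair-at-square S[y+1] =
      x , t , 1≤x , 2≤t , subst (N <_) y+1≡xt² (<-≤-trans N<y (n≤1+n y)) , Sx , subst S y+1≡xt² S[y+1]

  twoSyndetic⇒infManyPairs : InfManyPairs S
  twoSyndetic⇒infManyPairs N =
    let x , 1≤x , Sx       = positive-element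
        y , y+1≡xt² , N<y = suc-pred-of-square-multiple x (suc N) 1≤x
    in  pair-above (2 + N) Sx 1≤x (s≤s (s≤s z≤n)) y+1≡xt² N<y

lemma4p1 : (S : ℕ → Set) → TwoSyndetic S
           → ¬ ¬ (InfManyPairs S ⊎ InfManyOddSquares S)
lemma4p1 S syndetic ¬goal = ¬goal (inj₁ (twoSyndetic⇒infManyPairs syndetic))
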